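{- Let $n$ be a positive integer with exactly $k$ binary digits (i.e. $2^{k-1}\le n<2^k$) such that $B(n^2)=2B(n)-1$, and let $\nu$ be an integer with $\nu\ge k+2$. Then $N=2^\nu n-1$ satisfies $B(N)=B(N^2)$, where $B(x)$ denotes the number of ones in the binary expansion of $x$.
   Context: For a positive integer $x$, $B(x)$ denotes the sum of the binary digits of $x$ (its Hamming weight). -}

module Defs where

open import Data.Nat using (ℕ; zero; suc; _+_; _%_; _/_)

-- Sum of binary digits, computed by repeatedly taking the last bit.
-- The fuel argument bounds the number of steps; fuel x ≥ (number of bits of x)
-- always holds since x / 2 < x for x > 0.
B-fuel : ℕ → ℕ → ℕ
B-fuel zero    x = 0
B-fuel (suc f) x = x % 2 + B-fuel f (x / 2)

B : ℕ → ℕ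
B x = B-fuel x x

{-# OPTIONS --safe #-}
module Submission where

-- Write n = p + 1, 2^ν = 2E with E = 2^(ν-1) ≥ n, and e = E - n.  Then
-- N = 2^ν p + (2^ν - 1) and N² = 4E (E (n² - 1) + e) + 1 are concatenations of
-- binary blocks, so B(N) = B(p) + ν and B(N²) = B(n² - 1) + B(e) + 1, while
-- B(e) + B(p) = ν - 1 because e and p are complementary (ν-1)-bit blocks.
-- Finally the hypothesis on n is equivalent to B(n² - 1) = 2 B(n - 1): for
-- n = 2^t (2w + 1) one has B(n) = B(w) + 1 and B(n - 1) = B(w) + t, and n² has
-- the same shape with 2t in place of t.

open import Defs
open import Data.Nat using (ℕ; zero; suc; _+_; _*_; _∸_; _^_; _≤_; _<_; _%_; _/_; z≤n; s≤s; s≤s⁻¹; z<s)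
open import Data.Nat.Properties
open import Data.Nat.DivMod using (m/n<m; m*n%n≡0; m*n/n≡m; [m+kn]%n≡m%n; +-distrib-/-∣ʳ)
open import Data.Nat.Divisibility using (n∣m*n)
open import Data.Nat.Induction using (<-rec)
open import Data.Nat.Tactic.RingSolver using (solve-∀)
open import Data.Product using (∃₂; _,_)
open import Relation.Nullary using (contradiction)
open import Relation.Binary.PropositionalEquality
  using (_≡_; refl; sym; trans; cong; cong₂; subst; module ≡-Reasoning)
open ≡-Reasoning

B-fuel-zero : ∀ f → B-fuel f 0 ≡ 0
B-fuel-zero zero    = refl
B-fuel-zero (suc f) = B-fuel-zero f

/2-≤-pred : ∀ {x f} → x ≤ suc f → x / 2 ≤ f
/2-≤-pred {zero}  _         = z≤n
/2-≤-pred {suc x} (s≤s x≤f) = ≤-trans (s≤s⁻¹ (m/n<m (suc x) 2 (s≤s (s≤s z≤n)))) x≤f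

B-fuel-irrelevant : ∀ {f g x} → x ≤ f → x ≤ g → B-fuel f x ≡ B-fuel g x
B-fuel-irrelevant {zero}  {zero}  _   _   = refl
B-fuel-irrelevant {zero}  {suc g} z≤n _   = sym (B-fuel-zero g)
B-fuel-irrelevant {suc f} {zero}  _   z≤n = B-fuel-zero f
B-fuel-irrelevant {suc f} {suc g} {x} x≤f x≤g =
  cong (x % 2 +_) (B-fuel-irrelevant (/2-≤-pred x≤f) (/2-≤-pred x≤g))

B-step : ∀ x → B x ≡ x % 2 + B (x / 2)
B-step zero    = refl
B-step (suc x) = cong (suc x % 2 +_) (B-fuel-irrelevant {x} (/2-≤-pred ≤-refl) ≤-refl)

B-double : ∀ y → B (2 * y) ≡ B y
B-double y = begin
  B (2 * y)                     ≡⟨ B-step (2 * y) ⟩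
  (2 * y) % 2 + B ((2 * y) / 2) ≡⟨ cong (λ z → z % 2 + B (z / 2)) (*-comm 2 y) ⟩
  (y * 2) % 2 + B ((y * 2) / 2) ≡⟨ cong₂ _+_ (m*n%n≡0 y 2) (cong B (m*n/n≡m y 2)) ⟩
  B y                           ∎

B-double+1 : ∀ y → B (suc (2 * y)) ≡ suc (B y)
B-double+1 y = begin
  B (1 + 2 * y)                         ≡⟨ B-step (1 + 2 * y) ⟩
  (1 + 2 * y) % 2 + B ((1 + 2 * y) / 2) ≡⟨ cong (λ z → (1 + z) % 2 + B ((1 + z) / 2)) (*-comm 2 y) ⟩
  (1 + y * 2) % 2 + B ((1 + y * 2) / 2) ≡⟨ cong₂ _+_ ([m+kn]%n≡m%n 1 y 2)
                                                      (cong B (+-distrib-/-∣ʳ 1 {d = 2} (n∣m*n y))) ⟩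
  1 + B (y * 2 / 2)                     ≡⟨ cong (λ z → 1 + B z) (m*n/n≡m y 2) ⟩
  1 + B y                               ∎

data Parity : ℕ → Set where
  even : ∀ y → Parity (2 * y)
  odd  : ∀ y → Parity (suc (2 * y))

parity : ∀ x → Parity x
parity zero = even 0
parity (suc x) with parity x
... | even y = odd y
... | odd  y = subst Parity (*-suc 2 y) (even (suc y))

B-shift : ∀ t x → B (2 ^ t * x) ≡ B x
B-shift zero    x = cong B (*-identityˡ x)
B-shift (suc t) x = begin
  B (2 * 2 ^ t * x)   ≡⟨ cong B (*-assoc 2 (2 ^ t) x) ⟩
  B (2 * (2 ^ t * x)) ≡⟨ B-double (2 ^ t * x) ⟩
  B (2 ^ t * x)       ≡⟨ B-shift t x ⟩
  B x                 ∎

B-concat : ∀ m a {b} → b < 2 ^ m → B (2 ^ m * a + b) ≡ B a + B b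
B-concat zero a {zero} _ = begin
  B (1 * a + 0) ≡⟨ cong B (trans (+-identityʳ (1 * a)) (*-identityˡ a)) ⟩
  B a           ≡⟨ +-identityʳ (B a) ⟨
  B a + 0       ∎
B-concat zero a {suc b} (s≤s ())
B-concat (suc m) a {b} b<2^[1+m] with parity b
... | even q = begin
  B (2 * 2 ^ m * a + 2 * q) ≡⟨ cong B (shift-even (2 ^ m) a q) ⟩
  B (2 * (2 ^ m * a + q))   ≡⟨ B-double (2 ^ m * a + q) ⟩
  B (2 ^ m * a + q)         ≡⟨ B-concat m a (*-cancelˡ-< 2 q (2 ^ m) b<2^[1+m]) ⟩
  B a + B q                 ≡⟨ cong (B a +_) (B-double q) ⟨
  B a + B (2 * q)           ∎
  where
  shift-even : ∀ G a q → 2 * G * a + 2 * q ≡ 2 * (G * a + q)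
  shift-even = solve-∀
... | odd q = begin
  B (2 * 2 ^ m * a + suc (2 * q)) ≡⟨ cong B (shift-odd (2 ^ m) a q) ⟩
  B (suc (2 * (2 ^ m * a + q)))   ≡⟨ B-double+1 (2 ^ m * a + q) ⟩
  suc (B (2 ^ m * a + q))         ≡⟨ cong suc (B-concat m a (*-cancelˡ-< 2 q (2 ^ m) (≤-trans (n≤1+n _) b<2^[1+m]))) ⟩
  suc (B a + B q)                 ≡⟨ +-suc (B a) (B q) ⟨
  B a + suc (B q)                 ≡⟨ cong (B a +_) (B-double+1 q) ⟨
  B a + B (suc (2 * q))           ∎
  where
  shift-odd : ∀ G a q → 2 * G * a + suc (2 * q) ≡ suc (2 * (G * a + q))
  shift-odd = solve-∀

B-complement : ∀ m a c → a + suc c ≡ 2 ^ m → B a + B c ≡ m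
B-complement zero zero    zero    _  = refl
B-complement zero zero    (suc c) ()
B-complement zero (suc a) c       eq = contradiction (suc-injective eq) (m+1+n≢0 a)
B-complement (suc m) a c eq with parity a | parity c
... | even x | even y = contradiction (trans (sym eq) (sum-odd x y)) (even≢odd (2 ^ m) (x + y))
  where
  sum-odd : ∀ x y → 2 * x + suc (2 * y) ≡ suc (2 * (x + y))
  sum-odd = solve-∀
... | odd x | odd y = contradiction (trans (sym eq) (sum-odd x y)) (even≢odd (2 ^ m) (suc (x + y)))
  where
  sum-odd : ∀ x y → suc (2 * x) + suc (suc (2 * y)) ≡ suc (2 * suc (x + y))
  sum-odd = solve-∀
... | even x | odd y = begin
  B (2 * x) + B (suc (2 * y)) ≡⟨ cong₂ _+_ (B-double x) (B-double+1 y) ⟩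
  B x + suc (B y)             ≡⟨ +-suc (B x) (B y) ⟩
  suc (B x + B y)             ≡⟨ cong suc (B-complement m x y (*-cancelˡ-≡ _ _ 2 (trans (sym (sum-even x y)) eq))) ⟩
  suc m                       ∎
  where
  sum-even : ∀ x y → 2 * x + suc (suc (2 * y)) ≡ 2 * (x + suc y)
  sum-even = solve-∀
... | odd x | even y = begin
  B (suc (2 * x)) + B (2 * y) ≡⟨ cong₂ _+_ (B-double+1 x) (B-double y) ⟩
  suc (B x + B y)             ≡⟨ cong suc (B-complement m x y (*-cancelˡ-≡ _ _ 2 (trans (sym (sum-even x y)) eq))) ⟩
  suc m                       ∎
  where
  sum-even : ∀ x y → suc (2 * x) + suc (2 * y) ≡ 2 * (x + suc y)
  sum-even = solve-∀

B-all-ones : ∀ t → B (2 ^ t ∸ 1) ≡ t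
B-all-ones t = trans (sym (+-identityʳ _)) (B-complement t (2 ^ t ∸ 1) 0 (m∸n+n≡m (m^n>0 2 t)))

B-shift-pred : ∀ t x → B (2 ^ t * suc x ∸ 1) ≡ B x + t
B-shift-pred t x = begin
  B (2 ^ t * suc x ∸ 1)       ≡⟨ cong (λ z → B (z ∸ 1)) (trans (*-suc (2 ^ t) x) (+-comm (2 ^ t) (2 ^ t * x))) ⟩
  B (2 ^ t * x + 2 ^ t ∸ 1)   ≡⟨ cong B (+-∸-assoc (2 ^ t * x) (m^n>0 2 t)) ⟩
  B (2 ^ t * x + (2 ^ t ∸ 1)) ≡⟨ B-concat t x (∸-monoʳ-< z<s (m^n>0 2 t)) ⟩
  B x + B (2 ^ t ∸ 1)         ≡⟨ cong (B x +_) (B-all-ones t) ⟩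
  B x + t                     ∎

OddPart : ℕ → Set
OddPart n = ∃₂ λ t w → n ≡ 2 ^ t * suc (2 * w)

odd-part : ∀ n → OddPart (suc n)
odd-part = <-rec (λ n → OddPart (suc n)) decompose
  where
  decompose : ∀ n → (∀ {m} → m < n → OddPart (suc m)) → OddPart (suc n)
  decompose n rec with parity n
  ... | even y = 0 , y , sym (*-identityˡ _)
  ... | odd y with rec (s≤s (m≤m+n y (y + 0)))
  ...   | t , w , 1+y≡2^t*o = suc t , w , (begin
    2 + 2 * y                 ≡⟨ *-suc 2 y ⟨
    2 * suc y                 ≡⟨ cong (2 *_) 1+y≡2^t*o ⟩
    2 * (2 ^ t * suc (2 * w)) ≡⟨ *-assoc 2 (2 ^ t) _ ⟨
    2 * 2 ^ t * suc (2 * w)   ∎)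

B-odd-part : ∀ t w → B (2 ^ t * suc (2 * w)) ≡ suc (B w)
B-odd-part t w = trans (B-shift t (suc (2 * w))) (B-double+1 w)

B-pred-odd-part : ∀ t w → B (2 ^ t * suc (2 * w) ∸ 1) ≡ B w + t
B-pred-odd-part t w = trans (B-shift-pred t (2 * w)) (cong (_+ t) (B-double w))

B-pred-square : ∀ n → OddPart n → B (n * n) ≡ 2 * B n ∸ 1 → B (n * n ∸ 1) ≡ 2 * B (n ∸ 1)
B-pred-square .(2 ^ t * suc (2 * w)) (t , w , refl) B[n²]≡2B[n]-1 = begin
  B (n * n ∸ 1)                        ≡⟨ cong (λ z → B (z ∸ 1)) n²≡2^[t+t]*o ⟩
  B (2 ^ (t + t) * suc (2 * w′) ∸ 1)   ≡⟨ B-pred-odd-part (t + t) w′ ⟩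
  B w′ + (t + t)                       ≡⟨ cong (_+ (t + t)) B[w′]≡2B[w] ⟩
  2 * B w + (t + t)                    ≡⟨ double-+ (B w) t ⟩
  2 * (B w + t)                        ≡⟨ cong (2 *_) (B-pred-odd-part t w) ⟨
  2 * B (n ∸ 1)                        ∎
  where
  n = 2 ^ t * suc (2 * w)
  w′ = 2 * w * w + 2 * w
  square-odd : ∀ G w → (G * suc (2 * w)) * (G * suc (2 * w)) ≡ G * G * suc (2 * (2 * w * w + 2 * w))
  square-odd = solve-∀
  double-+ : ∀ x t → 2 * x + (t + t) ≡ 2 * (x + t)
  double-+ = solve-∀
  n²≡2^[t+t]*o : n * n ≡ 2 ^ (t + t) * suc (2 * w′)
  n²≡2^[t+t]*o = trans (square-odd (2 ^ t) w) (cong (_* suc (2 * w′)) (sym (^-distribˡ-+-* 2 t t)))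
  B[w′]≡2B[w] : B w′ ≡ 2 * B w
  B[w′]≡2B[w] = suc-injective (begin
    suc (B w′)                     ≡⟨ B-odd-part (t + t) w′ ⟨
    B (2 ^ (t + t) * suc (2 * w′)) ≡⟨ cong B n²≡2^[t+t]*o ⟨
    B (n * n)                      ≡⟨ B[n²]≡2B[n]-1 ⟩
    2 * B n ∸ 1                    ≡⟨ cong (λ b → 2 * b ∸ 1) (B-odd-part t w) ⟩
    2 * suc (B w) ∸ 1              ≡⟨ cong (_∸ 1) (*-suc 2 (B w)) ⟩
    suc (2 * B w)                  ∎)

square-2En∸1 : ∀ E p e → e + suc p ≡ E →
  (2 * E * suc p ∸ 1) * (2 * E * suc p ∸ 1) ≡ 2 * (2 * E) * (E * (suc p * suc p ∸ 1) + e) + 1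
square-2En∸1 .(e + suc p) p e refl = begin
  N * N ≡⟨ cong (λ z → z * z) (cong (_∸ 1) (2En≡1+X e p)) ⟩
  X * X ≡⟨ expand e p ⟩
  2 * (2 * E) * (E * (p + p * suc p) + e) + 1 ∎
  where
  E = e + suc p
  N = 2 * E * suc p ∸ 1
  X = 2 * E * p + 2 * e + 2 * p + 1
  2En≡1+X : ∀ e p → 2 * (e + suc p) * suc p ≡ suc (2 * (e + suc p) * p + 2 * e + 2 * p + 1)
  2En≡1+X = solve-∀
  expand : ∀ e p → let E = e + suc p ; X = 2 * E * p + 2 * e + 2 * p + 1 in
    X * X ≡ 2 * (2 * E) * (E * (p + p * suc p) + e) + 1
  expand = solve-∀

B-square-shift-pred : ∀ μ p e → e + suc p ≡ 2 ^ μ →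
  B ((2 ^ suc μ * suc p ∸ 1) * (2 ^ suc μ * suc p ∸ 1)) + B p ≡ B (suc p * suc p ∸ 1) + suc μ
B-square-shift-pred μ p e e+n≡E = begin
  B (N * N) + B p                             ≡⟨ cong (λ z → B z + B p) (square-2En∸1 E p e e+n≡E) ⟩
  B (2 ^ suc (suc μ) * (E * s + e) + 1) + B p ≡⟨ cong (_+ B p) (B-concat (suc (suc μ)) (E * s + e) 1<4E) ⟩
  B (E * s + e) + 1 + B p                     ≡⟨ cong (λ z → z + 1 + B p) (B-concat μ s e<E) ⟩
  B s + B e + 1 + B p                         ≡⟨ regroup (B s) (B e) (B p) ⟩
  B s + suc (B e + B p)                       ≡⟨ cong (λ z → B s + suc z) (B-complement μ e p e+n≡E) ⟩
  B s + suc μ                                 ∎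
  where
  E = 2 ^ μ
  N = 2 ^ suc μ * suc p ∸ 1
  s = suc p * suc p ∸ 1
  1<4E : 1 < 2 ^ suc (suc μ)
  1<4E = *-monoʳ-≤ 2 (m^n>0 2 (suc μ))
  e<E : e < E
  e<E = <-≤-trans (m<m+n e z<s) (≤-reflexive e+n≡E)
  regroup : ∀ a b c → a + b + 1 + c ≡ a + suc (b + c)
  regroup = solve-∀

-- The lower bound 2^(k-1) ≤ n only fixes k as the bit length of n: the argument
-- needs nothing beyond n ≤ 2^(ν-1).
corollary1 : (n k ν : ℕ) → 1 ≤ n → 2 ^ (k ∸ 1) ≤ n → n < 2 ^ k →
    B (n * n) ≡ 2 * B n ∸ 1 → k + 2 ≤ ν →
    B (2 ^ ν * n ∸ 1) ≡ B ((2 ^ ν * n ∸ 1) * (2 ^ ν * n ∸ 1))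
corollary1 zero    _ _    ()
corollary1 (suc p) k zero _ _ _ _ k+2≤0 = contradiction (m+n≤o⇒n≤o k k+2≤0) λ ()
corollary1 n@(suc p) k (suc μ) _ _ n<2^k B[n²]≡2B[n]-1 k+2≤ν = +-cancelʳ-≡ (B p) _ _ (begin
  B N + B p             ≡⟨ cong (_+ B p) (B-shift-pred (suc μ) p) ⟩
  B p + suc μ + B p     ≡⟨ regroup (B p) (suc μ) ⟨
  2 * B p + suc μ       ≡⟨ cong (_+ suc μ) (B-pred-square n (odd-part p) B[n²]≡2B[n]-1) ⟨
  B (n * n ∸ 1) + suc μ ≡⟨ B-square-shift-pred μ p e e+n≡2^μ ⟨
  B (N * N) + B p       ∎)
  where
  N = 2 ^ suc μ * n ∸ 1
  n≤2^μ : n ≤ 2 ^ μ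
  n≤2^μ = ≤-trans (<⇒≤ n<2^k) (^-monoʳ-≤ 2 (<⇒≤ (s≤s⁻¹ (subst (_≤ suc μ) (+-comm k 2) k+2≤ν))))
  e = 2 ^ μ ∸ n
  e+n≡2^μ : e + n ≡ 2 ^ μ
  e+n≡2^μ = m∸n+n≡m n≤2^μ
  regroup : ∀ b ν → 2 * b + ν ≡ b + ν + b
  regroup = solve-∀
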